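{- For $n\ge 2$ define the polynomial in $x$ (with parameter $t$) $$h_n(x;t)=\sum_{d=1}^{n-1}\sum_{i=1}^{d}\binom{n-i-1}{d-i}\binom{n-d-1}{i-1}\,t^i x^d,$$ and let $h_n'$, $h_n''$ denote derivatives with respect to $x$. Then for $n\ge 2$: $$h_{n+2}(x;t)=(1+x)h_{n+1}(x;t)+tx\,h_n(x;t),$$ $$A\,h_{n+1}(x;t)=B\,h_n(x;t)+C\,h_n'(x;t),$$ $$\widetilde A\,h_{n+1}(x;t)=\widetilde B\,h_n(x;t)+C^2\,h_n''(x;t),$$ where $A=(n-1)(x-1)$, $B=-n(2tx+x+1)$, $C=x(x^2+4tx+2x+1)$, $$\widetilde A=(n-1)\big((n-2)x^3+(4nt+n-2t+2)x^2-(4nt+n-6t-4)x-n\big),$$ $$\widetilde B=-n\big((nt-5t-2)x^3+(4nt^2+2nt-8t^2+n-6t-5)x^2+(5nt+2n-9t-4)x+n-1\big).$$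
   Context: Binomial coefficients $\binom{m}{k}$ are taken to be $0$ when $k>m$ or $k<0$. Equivalently $h_n(x;t)=\sum_{d=1}^{n-1}g_{U_{n,d}}(t)x^d$, where $g_{U_{n,d}}(t)=\sum_{i=1}^{\min(d,n-d)}\frac{(n-i-1)!}{(d-i)!(n-d-i)!(i-1)!}t^i$ is Speyer's $g$-polynomial of the uniform matroid $U_{n,d}$. -}

module Defs where

open import Data.Nat as ℕ using (ℕ; zero; suc; _≤ᵇ_; _<ᵇ_; _∸_)
open import Data.Nat.Combinatorics using (_C_)
open import Data.Bool using (Bool; if_then_else_; _∧_)
open import Data.Integer as ℤ using (ℤ; +_)
open import Relation.Binary.PropositionalEquality using (_≡_)

-- Polynomials in ℤ[t,x], represented by their coefficient functions:
-- p i d is the coefficient of t^i x^d.  (Finite support is not needed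
-- for the statements below; all polynomials used are finitely supported.)
Poly : Set
Poly = ℕ → ℕ → ℤ

infix 4 _≈P_
_≈P_ : Poly → Poly → Set
p ≈P q = ∀ i d → p i d ≡ q i d

Σ≤ : ℕ → (ℕ → ℤ) → ℤ
Σ≤ zero    f = f 0
Σ≤ (suc m) f = Σ≤ m f ℤ.+ f (suc m)

cst : ℤ → Poly
cst c zero zero = c
cst c _    _    = + 0

X : Poly
X zero (suc zero) = + 1
X _    _          = + 0

T : Poly
T (suc zero) zero = + 1
T _          _    = + 0

infixl 6 _+P_ _-P_
infixl 7 _*P_
_+P_ : Poly → Poly → Poly
(p +P q) i d = p i d ℤ.+ q i d

-P_ : Poly → Poly
(-P p) i d = ℤ.- p i d

_-P_ : Poly → Poly → Poly
p -P q = p +P (-P q)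

_*P_ : Poly → Poly → Poly
(p *P q) i d = Σ≤ i (λ a → Σ≤ d (λ b → p a b ℤ.* q (i ∸ a) (d ∸ b)))

ι : ℕ → Poly
ι n = cst (+ n)

∂x : Poly → Poly
∂x p i d = + (suc d) ℤ.* p i (suc d)

h : ℕ → Poly
h n i d =
  if (1 ≤ᵇ d) ∧ (d <ᵇ n) ∧ (1 ≤ᵇ i) ∧ (i ≤ᵇ d)
  then + (((n ∸ i ∸ 1) C (d ∸ i)) ℕ.* ((n ∸ d ∸ 1) C (i ∸ 1)))
  else + 0

A : ℕ → Poly
A n = ι (n ∸ 1) *P (X -P ι 1)

B : ℕ → Poly
B n = -P (ι n *P (ι 2 *P T *P X +P X +P ι 1))

C : Poly
C = X *P (X *P X +P ι 4 *P T *P X +P ι 2 *P X +P ι 1)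

X³ X² : Poly
X² = X *P X
X³ = X *P X *P X

Ã : ℕ → Poly
Ã n = ι (n ∸ 1) *P
  ( (ι n -P ι 2) *P X³
  +P (ι 4 *P ι n *P T +P ι n -P ι 2 *P T +P ι 2) *P X²
  -P (ι 4 *P ι n *P T +P ι n -P ι 6 *P T -P ι 4) *P X
  -P ι n )

B̃ : ℕ → Poly
B̃ n = -P (ι n *P
  ( (ι n *P T -P ι 5 *P T -P ι 2) *P X³
  +P (ι 4 *P ι n *P T *P T +P ι 2 *P ι n *P T -P ι 8 *P T *P T
      +P ι n -P ι 6 *P T -P ι 5) *P X²
  +P (ι 5 *P ι n *P T +P ι 2 *P ι n -P ι 9 *P T -P ι 4) *P X
  +P ι n -P ι 1 ))

{-# OPTIONS --safe #-}
module Submission where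

-- With i = 1 + b, d = 1 + b + a and n = 2 + b + a + e, the coefficient of t^i x^d in h n is
-- C(a + e, a) C(e, b), and the recurrence for h is Pascal's rule applied to both binomials.
-- A polynomial identity shows that the defect A n h (n+1) − B n h n − C h n′ of the first
-- differential equation obeys the same recurrence as h; it vanishes at n = 1 and n = 2, hence
-- always.  Differentiating the first equation at n and eliminating h (n+1)′ with the first
-- equation at n + 1 and the recurrence gives the second one.

open import Defs
open import Algebra.Bundles using (Semiring; CommutativeRing)
open import Algebra.Structures {A = Poly} _≈P_ using (IsCommutativeRing)
open import Algebra.Solver.Ring.AlmostCommutativeRing
  using (AlmostCommutativeRing; fromCommutativeRing; _-Raw-AlmostCommutative⟶_; Induced-equivalence)
open import Data.Bool using (true; false; if_then_else_) renaming (T to True)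
open import Data.Bool.Properties using (T-∧)
open import Data.Empty using (⊥-elim)
open import Data.Integer as ℤ using (ℤ; +_; -_)
import Data.Integer.Properties as ℤP
open import Algebra.Properties.CommutativeSemigroup ℤP.+-commutativeSemigroup using (interchange)
open import Algebra.Properties.CommutativeSemigroup ℤP.*-commutativeSemigroup using (x∙yz≈y∙xz)
open import Data.Maybe using (just; nothing)
open import Data.Nat as ℕ using (ℕ; zero; suc; _∸_; _≤_; _<_; z≤n; s≤s)
open import Data.Nat.Combinatorics using (nCn≡1; nCk+nC[k+1]≡[n+1]C[k+1]) renaming (_C_ to _choose_)
import Data.Nat.Properties as ℕP
open import Data.Nat.Tactic.RingSolver using (solve-∀)
open import Data.Product using (_×_; _,_; proj₁)
open import Function.Bundles using (module Equivalence)
open import Relation.Binary.Definitions using (WeaklyDecidable)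
open import Relation.Binary.PropositionalEquality
  using (_≡_; refl; sym; trans; cong; cong₂; module ≡-Reasoning)
import Relation.Binary.Reasoning.Setoid as SetoidReasoning
open import Relation.Nullary using (¬_; yes; no)
open Equivalence using (to; from)

module FiniteSums where

  open import Data.Integer using (_+_; _*_)

  Σ≤-cong-≤ : ∀ m {f g : ℕ → ℤ} → (∀ k → k ≤ m → f k ≡ g k) → Σ≤ m f ≡ Σ≤ m g
  Σ≤-cong-≤ zero    f≡g = f≡g 0 z≤n
  Σ≤-cong-≤ (suc m) f≡g =
    cong₂ _+_ (Σ≤-cong-≤ m (λ k k≤m → f≡g k (ℕP.m≤n⇒m≤1+n k≤m))) (f≡g (suc m) ℕP.≤-refl)

  Σ≤-cong : ∀ m {f g : ℕ → ℤ} → (∀ k → f k ≡ g k) → Σ≤ m f ≡ Σ≤ m g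
  Σ≤-cong m f≡g = Σ≤-cong-≤ m (λ k _ → f≡g k)

  Σ≤-distrib-+ : ∀ m (f g : ℕ → ℤ) → Σ≤ m (λ k → f k + g k) ≡ Σ≤ m f + Σ≤ m g
  Σ≤-distrib-+ zero    f g = refl
  Σ≤-distrib-+ (suc m) f g =
    trans (cong (_+ (f (suc m) + g (suc m))) (Σ≤-distrib-+ m f g)) (interchange (Σ≤ m f) (Σ≤ m g) _ _)

  *-distribˡ-Σ≤ : ∀ m c (f : ℕ → ℤ) → c * Σ≤ m f ≡ Σ≤ m (λ k → c * f k)
  *-distribˡ-Σ≤ zero    c f = refl
  *-distribˡ-Σ≤ (suc m) c f =
    trans (ℤP.*-distribˡ-+ c (Σ≤ m f) _) (cong (_+ c * f (suc m)) (*-distribˡ-Σ≤ m c f))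

  *-distribʳ-Σ≤ : ∀ m c (f : ℕ → ℤ) → Σ≤ m f * c ≡ Σ≤ m (λ k → f k * c)
  *-distribʳ-Σ≤ m c f = trans (ℤP.*-comm (Σ≤ m f) c)
    (trans (*-distribˡ-Σ≤ m c f) (Σ≤-cong m (λ k → ℤP.*-comm c (f k))))

  Σ≤-zero : ∀ m {f : ℕ → ℤ} → (∀ k → f k ≡ + 0) → Σ≤ m f ≡ + 0
  Σ≤-zero zero    f≡0 = f≡0 0
  Σ≤-zero (suc m) f≡0 = cong₂ _+_ (Σ≤-zero m f≡0) (f≡0 (suc m))

  Σ≤-suc : ∀ m (f : ℕ → ℤ) → Σ≤ (suc m) f ≡ f 0 + Σ≤ m (λ k → f (suc k))
  Σ≤-suc zero    f = refl
  Σ≤-suc (suc m) f = trans (cong (_+ f (suc (suc m))) (Σ≤-suc m f)) (ℤP.+-assoc (f 0) _ _)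

  Σ≤-supported-at-0 : ∀ m (f : ℕ → ℤ) → (∀ k → f (suc k) ≡ + 0) → Σ≤ m f ≡ f 0
  Σ≤-supported-at-0 zero    f f≡0 = refl
  Σ≤-supported-at-0 (suc m) f f≡0 =
    trans (Σ≤-suc m f) (trans (cong (λ z → f 0 + z) (Σ≤-zero m f≡0)) (ℤP.+-identityʳ (f 0)))

  Σ≤-reverse : ∀ m (f : ℕ → ℤ) → Σ≤ m f ≡ Σ≤ m (λ k → f (m ∸ k))
  Σ≤-reverse zero    f = refl
  Σ≤-reverse (suc m) f = begin
    Σ≤ m f + f (suc m)                    ≡⟨ ℤP.+-comm (Σ≤ m f) _ ⟩
    f (suc m) + Σ≤ m f                    ≡⟨ cong (λ z → f (suc m) + z) (Σ≤-reverse m f) ⟩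
    f (suc m) + Σ≤ m (λ k → f (m ∸ k))    ≡⟨ Σ≤-suc m (λ k → f (suc m ∸ k)) ⟨
    Σ≤ (suc m) (λ k → f (suc m ∸ k))      ∎
    where open ≡-Reasoning

  Σ≤-comm : ∀ m n (f : ℕ → ℕ → ℤ) →
    Σ≤ m (λ a → Σ≤ n (λ b → f a b)) ≡ Σ≤ n (λ b → Σ≤ m (λ a → f a b))
  Σ≤-comm zero    n f = refl
  Σ≤-comm (suc m) n f = trans (cong (_+ Σ≤ n (f (suc m))) (Σ≤-comm m n f)) (sym (Σ≤-distrib-+ n _ _))

  Σ≤-triangle : ∀ m (g : ℕ → ℕ → ℤ) →
    Σ≤ m (λ c → Σ≤ c (λ a → g c a)) ≡ Σ≤ m (λ a → Σ≤ (m ∸ a) (λ e → g (a ℕ.+ e) a))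
  Σ≤-triangle zero    g = refl
  Σ≤-triangle (suc m) g = begin
    Σ≤ m (λ c → Σ≤ c (g c)) + Σ≤ (suc m) (g (suc m))
      ≡⟨ cong (_+ Σ≤ (suc m) (g (suc m))) (Σ≤-triangle m g) ⟩
    S m + (Σ≤ m (g (suc m)) + g (suc m) (suc m))
      ≡⟨ ℤP.+-assoc (S m) _ _ ⟨
    (S m + Σ≤ m (g (suc m))) + g (suc m) (suc m)
      ≡⟨ cong₂ _+_ (trans (sym (Σ≤-distrib-+ m _ _)) (Σ≤-cong-≤ m extend))
                   (cong (λ z → g z (suc m)) (sym (ℕP.+-identityʳ (suc m)))) ⟩
    Σ≤ m (λ a → Σ≤ (suc m ∸ a) (λ e → g (a ℕ.+ e) a)) + g (suc m ℕ.+ 0) (suc m)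
      ≡⟨ cong (λ z → Σ≤ m (λ a → Σ≤ (suc m ∸ a) (λ e → g (a ℕ.+ e) a))
                      + Σ≤ z (λ e → g (suc m ℕ.+ e) (suc m))) (sym (ℕP.n∸n≡0 m)) ⟩
    Σ≤ (suc m) (λ a → Σ≤ (suc m ∸ a) (λ e → g (a ℕ.+ e) a)) ∎
    where
    open ≡-Reasoning
    S : ℕ → ℤ
    S m = Σ≤ m (λ a → Σ≤ (m ∸ a) (λ e → g (a ℕ.+ e) a))
    extend : ∀ a → a ≤ m →
      Σ≤ (m ∸ a) (λ e → g (a ℕ.+ e) a) + g (suc m) a ≡ Σ≤ (suc m ∸ a) (λ e → g (a ℕ.+ e) a)
    extend a a≤m rewrite ℕP.+-∸-assoc 1 a≤m =
      cong (λ z → Σ≤ (m ∸ a) (λ e → g (a ℕ.+ e) a) + g z a)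
        (trans (cong suc (sym (ℕP.m+[n∸m]≡n a≤m))) (sym (ℕP.+-suc a (m ∸ a))))

  Σ≤-convolution-assoc : ∀ n (G : ℕ → ℕ → ℕ → ℤ) →
    Σ≤ n (λ c → Σ≤ c (λ a → G a (c ∸ a) (n ∸ c))) ≡ Σ≤ n (λ a → Σ≤ (n ∸ a) (λ e → G a e (n ∸ a ∸ e)))
  Σ≤-convolution-assoc n G = trans (Σ≤-triangle n (λ c a → G a (c ∸ a) (n ∸ c)))
    (Σ≤-cong n (λ a → Σ≤-cong (n ∸ a) (λ e →
      cong₂ (G a) (ℕP.m+n∸m≡n a e) (sym (ℕP.∸-+-assoc n a e)))))

open FiniteSums

module _ {c ℓ} (R : Semiring c ℓ) where
  open Semiring R using (Carrier; 0#; _≈_; _+_; _*_; setoid; +-cong; *-congˡ; zeroʳ; +-identityʳ)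
  open SetoidReasoning setoid

  recurrence-from-zeros : ∀ (a b : Carrier) (u : ℕ → Carrier) → u 0 ≈ 0# → u 1 ≈ 0# →
    (∀ k → u (suc (suc k)) ≈ a * u (suc k) + b * u k) → ∀ k → u k ≈ 0#
  recurrence-from-zeros a b u u₀≈0 u₁≈0 rec k = proj₁ (consecutive k)
    where
    consecutive : ∀ k → u k ≈ 0# × u (suc k) ≈ 0#
    consecutive zero    = u₀≈0 , u₁≈0
    consecutive (suc k) with consecutive k
    ... | uₖ≈0 , uₖ₊₁≈0 = uₖ₊₁≈0 , (begin
      u (suc (suc k))          ≈⟨ rec k ⟩
      a * u (suc k) + b * u k  ≈⟨ +-cong (*-congˡ uₖ₊₁≈0) (*-congˡ uₖ≈0) ⟩
      a * 0# + b * 0#          ≈⟨ +-cong (zeroʳ a) (zeroʳ b) ⟩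
      0# + 0#                  ≈⟨ +-identityʳ 0# ⟩
      0#                       ∎)

module PolynomialRing where

  open import Data.Integer using (_+_; _*_)

  cst-0 : ∀ i d → cst (+ 0) i d ≡ + 0
  cst-0 zero    zero    = refl
  cst-0 zero    (suc d) = refl
  cst-0 (suc i) d       = refl

  ≈P-refl : ∀ {p} → p ≈P p
  ≈P-refl i d = refl

  ≈P-sym : ∀ {p q} → p ≈P q → q ≈P p
  ≈P-sym p≈q i d = sym (p≈q i d)

  ≈P-trans : ∀ {p q r} → p ≈P q → q ≈P r → p ≈P r
  ≈P-trans p≈q q≈r i d = trans (p≈q i d) (q≈r i d)

  +P-cong : ∀ {p p′ q q′} → p ≈P p′ → q ≈P q′ → p +P q ≈P p′ +P q′
  +P-cong p≈p′ q≈q′ i d = cong₂ _+_ (p≈p′ i d) (q≈q′ i d)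

  -P-cong : ∀ {p p′} → p ≈P p′ → -P p ≈P -P p′
  -P-cong p≈p′ i d = cong -_ (p≈p′ i d)

  *P-cong : ∀ {p p′ q q′} → p ≈P p′ → q ≈P q′ → p *P q ≈P p′ *P q′
  *P-cong p≈p′ q≈q′ i d =
    Σ≤-cong i (λ a → Σ≤-cong d (λ b → cong₂ _*_ (p≈p′ a b) (q≈q′ (i ∸ a) (d ∸ b))))

  +P-congʳ : ∀ r {p p′} → p ≈P p′ → p +P r ≈P p′ +P r
  +P-congʳ r p≈p′ = +P-cong p≈p′ (≈P-refl {r})

  *P-congˡ : ∀ p {q q′} → q ≈P q′ → p *P q ≈P p *P q′
  *P-congˡ p = *P-cong (≈P-refl {p})

  *P-congʳ : ∀ r {p p′} → p ≈P p′ → p *P r ≈P p′ *P r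
  *P-congʳ r p≈p′ = *P-cong p≈p′ (≈P-refl {r})

  +P-assoc : ∀ p q r → (p +P q) +P r ≈P p +P (q +P r)
  +P-assoc p q r i d = ℤP.+-assoc (p i d) (q i d) (r i d)

  +P-comm : ∀ p q → p +P q ≈P q +P p
  +P-comm p q i d = ℤP.+-comm (p i d) (q i d)

  +P-identityˡ : ∀ p → ι 0 +P p ≈P p
  +P-identityˡ p i d = trans (cong (_+ p i d) (cst-0 i d)) (ℤP.+-identityˡ (p i d))

  +P-identityʳ : ∀ p → p +P ι 0 ≈P p
  +P-identityʳ p = ≈P-trans (+P-comm p (ι 0)) (+P-identityˡ p)

  -P-inverseˡ : ∀ p → (-P p) +P p ≈P ι 0
  -P-inverseˡ p i d = trans (ℤP.+-inverseˡ (p i d)) (sym (cst-0 i d))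

  -P-inverseʳ : ∀ p → p +P (-P p) ≈P ι 0
  -P-inverseʳ p = ≈P-trans (+P-comm p (-P p)) (-P-inverseˡ p)

  *P-comm : ∀ p q → p *P q ≈P q *P p
  *P-comm p q i d = begin
    Σ≤ i (λ a → Σ≤ d (λ b → p a b * q (i ∸ a) (d ∸ b)))
      ≡⟨ Σ≤-reverse i _ ⟩
    Σ≤ i (λ a → Σ≤ d (λ b → p (i ∸ a) b * q (i ∸ (i ∸ a)) (d ∸ b)))
      ≡⟨ Σ≤-cong-≤ i (λ a a≤i → trans (Σ≤-reverse d _) (Σ≤-cong-≤ d (λ b b≤d →
           trans (cong₂ (λ a′ b′ → p (i ∸ a) (d ∸ b) * q a′ b′) (ℕP.m∸[m∸n]≡n a≤i) (ℕP.m∸[m∸n]≡n b≤d))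
                 (ℤP.*-comm (p (i ∸ a) (d ∸ b)) (q a b))))) ⟩
    Σ≤ i (λ a → Σ≤ d (λ b → q a b * p (i ∸ a) (d ∸ b))) ∎
    where open ≡-Reasoning

  *P-assoc : ∀ p q r → (p *P q) *P r ≈P p *P (q *P r)
  *P-assoc p q r i d = begin
    Σ≤ i (λ c → Σ≤ d (λ c′ → (p *P q) c c′ * r (i ∸ c) (d ∸ c′)))
      ≡⟨ Σ≤-cong i (λ c → Σ≤-cong d (λ c′ →
           trans (*-distribʳ-Σ≤ c _ _) (Σ≤-cong c (λ a → *-distribʳ-Σ≤ c′ _ _)))) ⟩
    Σ≤ i (λ c → Σ≤ d (λ c′ → Σ≤ c (λ a → Σ≤ c′ (λ a′ → F a a′ (c ∸ a) (c′ ∸ a′) (i ∸ c) (d ∸ c′)))))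
      ≡⟨ Σ≤-cong i (λ c → Σ≤-comm d c _) ⟩
    Σ≤ i (λ c → Σ≤ c (λ a → Σ≤ d (λ c′ → Σ≤ c′ (λ a′ → F a a′ (c ∸ a) (c′ ∸ a′) (i ∸ c) (d ∸ c′)))))
      ≡⟨ Σ≤-cong i (λ c → Σ≤-cong c (λ a →
           Σ≤-convolution-assoc d (λ a′ e′ f′ → F a a′ (c ∸ a) e′ (i ∸ c) f′))) ⟩
    Σ≤ i (λ c → Σ≤ c (λ a → Σ≤ d (λ a′ → Σ≤ (d ∸ a′) (λ e′ → F a a′ (c ∸ a) e′ (i ∸ c) (d ∸ a′ ∸ e′)))))
      ≡⟨ Σ≤-convolution-assoc i (λ a e f → Σ≤ d (λ a′ → Σ≤ (d ∸ a′) (λ e′ → F a a′ e e′ f (d ∸ a′ ∸ e′)))) ⟩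
    Σ≤ i (λ a → Σ≤ (i ∸ a) (λ e → Σ≤ d (λ a′ → Σ≤ (d ∸ a′) (λ e′ → F a a′ e e′ (i ∸ a ∸ e) (d ∸ a′ ∸ e′)))))
      ≡⟨ Σ≤-cong i (λ a → Σ≤-comm (i ∸ a) d _) ⟩
    Σ≤ i (λ a → Σ≤ d (λ a′ → Σ≤ (i ∸ a) (λ e → Σ≤ (d ∸ a′) (λ e′ → F a a′ e e′ (i ∸ a ∸ e) (d ∸ a′ ∸ e′)))))
      ≡⟨ Σ≤-cong i (λ a → Σ≤-cong d (λ a′ → trans
           (Σ≤-cong (i ∸ a) (λ e → trans (Σ≤-cong (d ∸ a′) (λ e′ → ℤP.*-assoc (p a a′) _ _))
                                          (sym (*-distribˡ-Σ≤ (d ∸ a′) (p a a′) _))))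
           (sym (*-distribˡ-Σ≤ (i ∸ a) (p a a′) _)))) ⟩
    Σ≤ i (λ a → Σ≤ d (λ a′ → p a a′ * (q *P r) (i ∸ a) (d ∸ a′))) ∎
    where
    open ≡-Reasoning
    F : ℕ → ℕ → ℕ → ℕ → ℕ → ℕ → ℤ
    F a a′ e e′ f f′ = p a a′ * q e e′ * r f f′

  *P-distribˡ-+P : ∀ p q r → p *P (q +P r) ≈P p *P q +P p *P r
  *P-distribˡ-+P p q r i d =
    trans (Σ≤-cong i (λ a → trans (Σ≤-cong d (λ b → ℤP.*-distribˡ-+ (p a b) _ _)) (Σ≤-distrib-+ d _ _)))
          (Σ≤-distrib-+ i _ _)

  *P-distribʳ-+P : ∀ p q r → (q +P r) *P p ≈P q *P p +P r *P p
  *P-distribʳ-+P p q r =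
    ≈P-trans (*P-comm (q +P r) p)
      (≈P-trans (*P-distribˡ-+P p q r) (+P-cong (*P-comm p q) (*P-comm p r)))

  *P-identityˡ : ∀ p → ι 1 *P p ≈P p
  *P-identityˡ p i d =
    trans (Σ≤-supported-at-0 i _ (λ k → Σ≤-zero d (λ b → ℤP.*-zeroˡ (p (i ∸ suc k) (d ∸ b)))))
      (trans (Σ≤-supported-at-0 d _ (λ k → ℤP.*-zeroˡ (p i (d ∸ suc k)))) (ℤP.*-identityˡ (p i d)))

  *P-identityʳ : ∀ p → p *P ι 1 ≈P p
  *P-identityʳ p = ≈P-trans (*P-comm p (ι 1)) (*P-identityˡ p)

  Poly-isCommutativeRing : IsCommutativeRing _+P_ _*P_ -P_ (ι 0) (ι 1)
  Poly-isCommutativeRing = record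
    { isRing = record
      { +-isAbelianGroup = record
        { isGroup = record
          { isMonoid = record
            { isSemigroup = record
              { isMagma = record
                { isEquivalence = record { refl = ≈P-refl ; sym = ≈P-sym ; trans = ≈P-trans }
                ; ∙-cong = +P-cong }
              ; assoc = +P-assoc }
            ; identity = +P-identityˡ , +P-identityʳ }
          ; inverse = -P-inverseˡ , -P-inverseʳ
          ; ⁻¹-cong = -P-cong }
        ; comm = +P-comm }
      ; *-cong = *P-cong
      ; *-assoc = *P-assoc
      ; *-identity = *P-identityˡ , *P-identityʳ
      ; distrib = *P-distribˡ-+P , *P-distribʳ-+P }
    ; *-comm = *P-comm }

  Poly-commutativeRing : CommutativeRing _ _
  Poly-commutativeRing = record { isCommutativeRing = Poly-isCommutativeRing }

  cst-+ : ∀ a b → cst (a + b) ≈P cst a +P cst b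
  cst-+ a b zero    zero    = refl
  cst-+ a b zero    (suc d) = refl
  cst-+ a b (suc i) d       = refl

  cst-* : ∀ a b → cst (a * b) ≈P cst a *P cst b
  cst-* a b i d = sym (trans (Σ≤-supported-at-0 i _ (λ k → Σ≤-zero d (λ _ → refl)))
    (trans (Σ≤-supported-at-0 d _ (λ k → refl)) (a*cst-b i d)))
    where
    a*cst-b : ∀ i d → a * cst b i d ≡ cst (a * b) i d
    a*cst-b zero    zero    = refl
    a*cst-b zero    (suc d) = ℤP.*-zeroʳ a
    a*cst-b (suc i) d       = ℤP.*-zeroʳ a

  cst-- : ∀ a → cst (- a) ≈P -P cst a
  cst-- a zero    zero    = refl
  cst-- a zero    (suc d) = refl
  cst-- a (suc i) d       = refl

  Poly-almostCommutativeRing : AlmostCommutativeRing _ _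
  Poly-almostCommutativeRing = fromCommutativeRing Poly-commutativeRing

  cst-homomorphism : ℤ.+-*-rawRing -Raw-AlmostCommutative⟶ Poly-almostCommutativeRing
  cst-homomorphism = record
    { ⟦_⟧    = cst
    ; +-homo = cst-+
    ; *-homo = cst-*
    ; -‿homo = cst--
    ; 0-homo = ≈P-refl
    ; 1-homo = ≈P-refl
    }

  cst-≟ : WeaklyDecidable (Induced-equivalence cst-homomorphism)
  cst-≟ a b with a ℤ.≟ b
  ... | yes a≡b = just (λ i d → cong (λ c → cst c i d) a≡b)
  ... | no  _   = nothing

  ι-suc : ∀ m → ι (suc m) ≈P ι m +P ι 1
  ι-suc m zero    zero    = cong +_ (ℕP.+-comm 1 m)
  ι-suc m zero    (suc d) = refl
  ι-suc m (suc i) d       = refl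

  ι-pred : ∀ m → ι m ≈P ι (suc m) -P ι 1
  ι-pred m zero    zero    = refl
  ι-pred m zero    (suc d) = refl
  ι-pred m (suc i) d       = refl

open PolynomialRing

open import Algebra.Solver.Ring ℤ.+-*-rawRing Poly-almostCommutativeRing cst-homomorphism cst-≟
  using (Polynomial; con; _:+_; _:*_; :-_; _:-_; _:=_; solve)

module ≈P-Reasoning = SetoidReasoning (CommutativeRing.setoid Poly-commutativeRing)

open import Algebra.Properties.Group (CommutativeRing.+-group Poly-commutativeRing) using (x∙y⁻¹≈ε⇒x≈y)

module Differentiation where

  open import Data.Integer using (_+_; _*_)

  ∂x-cong : ∀ {p q} → p ≈P q → ∂x p ≈P ∂x q
  ∂x-cong p≈q i d = cong (+ suc d *_) (p≈q i (suc d))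

  ∂x-+P : ∀ p q → ∂x (p +P q) ≈P ∂x p +P ∂x q
  ∂x-+P p q i d = ℤP.*-distribˡ-+ (+ suc d) (p i (suc d)) (q i (suc d))

  ∂x--P : ∀ p → ∂x (-P p) ≈P -P ∂x p
  ∂x--P p i d = sym (ℤP.neg-distribʳ-* (+ suc d) (p i (suc d)))

  ∂x-cst : ∀ c → ∂x (cst c) ≈P ι 0
  ∂x-cst c zero    zero    = ℤP.*-zeroʳ (+ 1)
  ∂x-cst c zero    (suc d) = ℤP.*-zeroʳ (+ suc (suc d))
  ∂x-cst c (suc i) d       = ℤP.*-zeroʳ (+ suc d)

  ∂x-X : ∂x X ≈P ι 1
  ∂x-X zero    zero    = refl
  ∂x-X zero    (suc d) = ℤP.*-zeroʳ (+ suc (suc d))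
  ∂x-X (suc i) d       = ℤP.*-zeroʳ (+ suc d)

  ∂x-T : ∂x T ≈P ι 0
  ∂x-T zero          zero    = refl
  ∂x-T zero          (suc d) = ℤP.*-zeroʳ (+ suc (suc d))
  ∂x-T (suc zero)    zero    = refl
  ∂x-T (suc zero)    (suc d) = ℤP.*-zeroʳ (+ suc (suc d))
  ∂x-T (suc (suc i)) d       = ℤP.*-zeroʳ (+ suc d)

  -- Split the weight d + 1 of the term P b Q (d + 1 − b) as b + (d + 1 − b).
  leibniz-Σ≤ : ∀ d (P Q : ℕ → ℤ) →
    + suc d * Σ≤ (suc d) (λ b → P b * Q (suc d ∸ b))
    ≡ Σ≤ d (λ b → (+ suc b * P (suc b)) * Q (d ∸ b)) + Σ≤ d (λ b → P b * (+ suc (d ∸ b) * Q (suc (d ∸ b))))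
  leibniz-Σ≤ d P Q = begin
    + suc d * Σ≤ (suc d) (λ b → R b)
      ≡⟨ *-distribˡ-Σ≤ (suc d) (+ suc d) _ ⟩
    Σ≤ (suc d) (λ b → + suc d * R b)
      ≡⟨ Σ≤-cong-≤ (suc d) split ⟩
    Σ≤ (suc d) (λ b → + b * R b + + (suc d ∸ b) * R b)
      ≡⟨ Σ≤-distrib-+ (suc d) _ _ ⟩
    Σ≤ (suc d) (λ b → + b * R b) + Σ≤ (suc d) (λ b → + (suc d ∸ b) * R b)
      ≡⟨ cong₂ _+_ differentiate-P differentiate-Q ⟩
    Σ≤ d (λ b → (+ suc b * P (suc b)) * Q (d ∸ b)) + Σ≤ d (λ b → P b * (+ suc (d ∸ b) * Q (suc (d ∸ b)))) ∎
    where
    open ≡-Reasoning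
    R : ℕ → ℤ
    R b = P b * Q (suc d ∸ b)
    split : ∀ b → b ≤ suc d → + suc d * R b ≡ + b * R b + + (suc d ∸ b) * R b
    split b b≤ = begin
      + suc d * R b                   ≡⟨ cong (λ z → + z * R b) (ℕP.m+[n∸m]≡n b≤) ⟨
      + (b ℕ.+ (suc d ∸ b)) * R b     ≡⟨ ℤP.*-distribʳ-+ (R b) (+ b) (+ (suc d ∸ b)) ⟩
      + b * R b + + (suc d ∸ b) * R b ∎
    differentiate-P : Σ≤ (suc d) (λ b → + b * R b) ≡ Σ≤ d (λ b → (+ suc b * P (suc b)) * Q (d ∸ b))
    differentiate-P = trans (Σ≤-suc d _)
      (trans (cong₂ _+_ (ℤP.*-zeroˡ (R 0)) (Σ≤-cong d (λ b → sym (ℤP.*-assoc (+ suc b) (P (suc b)) _))))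
             (ℤP.+-identityˡ _))
    differentiate-Q : Σ≤ (suc d) (λ b → + (suc d ∸ b) * R b)
                    ≡ Σ≤ d (λ b → P b * (+ suc (d ∸ b) * Q (suc (d ∸ b))))
    differentiate-Q = trans
      (cong₂ _+_
        (Σ≤-cong-≤ d (λ b b≤d → trans (cong (λ z → + z * (P b * Q z)) (ℕP.+-∸-assoc 1 b≤d))
                                      (x∙yz≈y∙xz (+ suc (d ∸ b)) (P b) (Q (suc (d ∸ b))))))
        (trans (cong (λ z → + z * R (suc d)) (ℕP.n∸n≡0 d)) (ℤP.*-zeroˡ (R (suc d)))))
      (ℤP.+-identityʳ _)

  ∂x-*P : ∀ p q → ∂x (p *P q) ≈P ∂x p *P q +P p *P ∂x q
  ∂x-*P p q i d = trans (*-distribˡ-Σ≤ i (+ suc d) _)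
    (trans (Σ≤-cong i (λ a → leibniz-Σ≤ d (p a) (q (i ∸ a)))) (Σ≤-distrib-+ i _ _))

open Differentiation

infixl 6 _`+_ _`-_
infixl 7 _`*_
infix  8 `-_

data Expr : Set where
  `x `t `n  : Expr
  `lit      : ℕ → Expr
  _`+_ _`*_ : Expr → Expr → Expr
  `-_       : Expr → Expr

_`-_ : Expr → Expr → Expr
a `- b = a `+ `- b

-- `n keeps the parameter n of the theorem symbolic, so identities are checked uniformly in n.
⟦_⟧ : Expr → Poly → Poly
⟦ `x     ⟧ N = X
⟦ `t     ⟧ N = T
⟦ `n     ⟧ N = N
⟦ `lit k ⟧ N = ι k
⟦ a `+ b ⟧ N = ⟦ a ⟧ N +P ⟦ b ⟧ N
⟦ a `* b ⟧ N = ⟦ a ⟧ N *P ⟦ b ⟧ N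
⟦ `- a   ⟧ N = -P ⟦ a ⟧ N

⟦⟧-cong : ∀ e {N N′} → N ≈P N′ → ⟦ e ⟧ N ≈P ⟦ e ⟧ N′
⟦⟧-cong `x       N≈N′ = ≈P-refl
⟦⟧-cong `t       N≈N′ = ≈P-refl
⟦⟧-cong `n       N≈N′ = N≈N′
⟦⟧-cong (`lit k) N≈N′ = ≈P-refl
⟦⟧-cong (a `+ b) N≈N′ = +P-cong (⟦⟧-cong a N≈N′) (⟦⟧-cong b N≈N′)
⟦⟧-cong (a `* b) N≈N′ = *P-cong (⟦⟧-cong a N≈N′) (⟦⟧-cong b N≈N′)
⟦⟧-cong (`- a)   N≈N′ = -P-cong (⟦⟧-cong a N≈N′)

∂ₑ : Expr → Expr
∂ₑ `x       = `lit 1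
∂ₑ `t       = `lit 0
∂ₑ `n       = `lit 0
∂ₑ (`lit k) = `lit 0
∂ₑ (a `+ b) = ∂ₑ a `+ ∂ₑ b
∂ₑ (a `* b) = ∂ₑ a `* b `+ a `* ∂ₑ b
∂ₑ (`- a)   = `- ∂ₑ a

∂ₑ-sound : ∀ N → ∂x N ≈P ι 0 → ∀ e → ∂x (⟦ e ⟧ N) ≈P ⟦ ∂ₑ e ⟧ N
∂ₑ-sound N ∂N≈0 `x       = ∂x-X
∂ₑ-sound N ∂N≈0 `t       = ∂x-T
∂ₑ-sound N ∂N≈0 `n       = ∂N≈0
∂ₑ-sound N ∂N≈0 (`lit k) = ∂x-cst (+ k)
∂ₑ-sound N ∂N≈0 (a `+ b) =
  ≈P-trans (∂x-+P (⟦ a ⟧ N) (⟦ b ⟧ N)) (+P-cong (∂ₑ-sound N ∂N≈0 a) (∂ₑ-sound N ∂N≈0 b))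
∂ₑ-sound N ∂N≈0 (a `* b) =
  ≈P-trans (∂x-*P (⟦ a ⟧ N) (⟦ b ⟧ N))
    (+P-cong (*P-congʳ (⟦ b ⟧ N) (∂ₑ-sound N ∂N≈0 a)) (*P-congˡ (⟦ a ⟧ N) (∂ₑ-sound N ∂N≈0 b)))
∂ₑ-sound N ∂N≈0 (`- a)   = ≈P-trans (∂x--P (⟦ a ⟧ N)) (-P-cong (∂ₑ-sound N ∂N≈0 a))

-- The solver evaluates ⟦ e ⟧ₛ n t x at n, t, x ↦ N, T, X to ⟦ e ⟧ N on the nose, so identities
-- stated with ⟦_⟧ (and nextₛ, ode₁-defectₛ below) can be handed to it.
⟦_⟧ₛ : ∀ {k} → Expr → (n t x : Polynomial k) → Polynomial k
⟦ `x     ⟧ₛ n t x = x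
⟦ `t     ⟧ₛ n t x = t
⟦ `n     ⟧ₛ n t x = n
⟦ `lit c ⟧ₛ n t x = con (+ c)
⟦ a `+ b ⟧ₛ n t x = ⟦ a ⟧ₛ n t x :+ ⟦ b ⟧ₛ n t x
⟦ a `* b ⟧ₛ n t x = ⟦ a ⟧ₛ n t x :* ⟦ b ⟧ₛ n t x
⟦ `- a   ⟧ₛ n t x = :- ⟦ a ⟧ₛ n t x

-- At N = ι n these are B n, C and B̃ n on the nose, while A n and Ã n have ι (n ∸ 1) where
-- `A and `Ã have `n − 1; see A-as-expr and Ã-as-expr.
`A `B `C `Ã₀ `Ã `B̃ : Expr
`A = (`n `- `lit 1) `* (`x `- `lit 1)
`B = `- (`n `* (`lit 2 `* `t `* `x `+ `x `+ `lit 1))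
`C = `x `* (`x `* `x `+ `lit 4 `* `t `* `x `+ `lit 2 `* `x `+ `lit 1)
`Ã = (`n `- `lit 1) `* `Ã₀
`Ã₀ =
  ( (`n `- `lit 2) `* (`x `* `x `* `x)
  `+ (`lit 4 `* `n `* `t `+ `n `- `lit 2 `* `t `+ `lit 2) `* (`x `* `x)
  `- (`lit 4 `* `n `* `t `+ `n `- `lit 6 `* `t `- `lit 4) `* `x
  `- `n )
`B̃ = `- (`n `*
  ( (`n `* `t `- `lit 5 `* `t `- `lit 2) `* (`x `* `x `* `x)
  `+ (`lit 4 `* `n `* `t `* `t `+ `lit 2 `* `n `* `t `- `lit 8 `* `t `* `t
      `+ `n `- `lit 6 `* `t `- `lit 5) `* (`x `* `x)
  `+ (`lit 5 `* `n `* `t `+ `lit 2 `* `n `- `lit 9 `* `t `- `lit 4) `* `x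
  `+ `n `- `lit 1 ))

A-as-expr : ∀ m → A (suc m) ≈P ⟦ `A ⟧ (ι (suc m))
A-as-expr m = *P-congʳ (X -P ι 1) (ι-pred m)

Ã-as-expr : ∀ m → Ã (suc m) ≈P ⟦ `Ã ⟧ (ι (suc m))
Ã-as-expr m = *P-congʳ (⟦ `Ã₀ ⟧ (ι (suc m))) (ι-pred m)

module Shifts where

  open import Data.Integer using (_+_; _*_)

  shiftX shiftT : Poly → Poly
  shiftX p i zero    = + 0
  shiftX p i (suc d) = p i d
  shiftT p zero    d = + 0
  shiftT p (suc i) d = p i d

  shiftT-cong : ∀ {p q} → p ≈P q → shiftT p ≈P shiftT q
  shiftT-cong p≈q zero    d = refl
  shiftT-cong p≈q (suc i) d = p≈q i d

  X*P≈shiftX : ∀ p → X *P p ≈P shiftX p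
  X*P≈shiftX p i d =
    trans (Σ≤-supported-at-0 i _ (λ k → Σ≤-zero d (λ b → ℤP.*-zeroˡ (p (i ∸ suc k) (d ∸ b))))) (column d)
    where
    column : ∀ d → Σ≤ d (λ b → X 0 b * p i (d ∸ b)) ≡ shiftX p i d
    column zero    = ℤP.*-zeroˡ (p i 0)
    column (suc d) = trans (Σ≤-suc d _)
      (trans (cong₂ _+_ (ℤP.*-zeroˡ (p i (suc d)))
                        (Σ≤-supported-at-0 d _ (λ k → ℤP.*-zeroˡ (p i (d ∸ suc k)))))
             (trans (ℤP.+-identityˡ _) (ℤP.*-identityˡ (p i d))))

  T*P≈shiftT : ∀ p → T *P p ≈P shiftT p
  T*P≈shiftT p i d =
    trans (Σ≤-cong i (λ a → Σ≤-supported-at-0 d _ (λ k →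
            trans (cong (_* p (i ∸ a) (d ∸ suc k)) (T-x-free a k)) (ℤP.*-zeroˡ (p (i ∸ a) (d ∸ suc k))))))
          (row i)
    where
    T-x-free : ∀ a b → T a (suc b) ≡ + 0
    T-x-free zero          b = refl
    T-x-free (suc zero)    b = refl
    T-x-free (suc (suc a)) b = refl
    row : ∀ i → Σ≤ i (λ a → T a 0 * p (i ∸ a) d) ≡ shiftT p i d
    row zero    = ℤP.*-zeroˡ (p 0 d)
    row (suc i) = trans (Σ≤-suc i _)
      (trans (cong₂ _+_ (ℤP.*-zeroˡ (p (suc i) d))
                        (Σ≤-supported-at-0 i _ (λ k → ℤP.*-zeroˡ (p (i ∸ suc k) d))))
             (trans (ℤP.+-identityˡ _) (ℤP.*-identityˡ (p i d))))

open Shifts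

next : Poly → Poly → Poly
next v u = (ι 1 +P X) *P v +P T *P X *P u

nextₛ : ∀ {k} → (t x v u : Polynomial k) → Polynomial k
nextₛ t x v u = (con (+ 1) :+ x) :* v :+ t :* x :* u

next-cong : ∀ {v v′ u u′} → v ≈P v′ → u ≈P u′ → next v u ≈P next v′ u′
next-cong v≈v′ u≈u′ = +P-cong (*P-congˡ (ι 1 +P X) v≈v′) (*P-congˡ (T *P X) u≈u′)

∂x-next : ∀ v u → ∂x (next v u) ≈P next (∂x v) (∂x u) +P v +P T *P u
∂x-next v u = begin
  ∂x ((ι 1 +P X) *P v +P T *P X *P u)
    ≈⟨ ≈P-trans (∂x-+P ((ι 1 +P X) *P v) (T *P X *P u)) (+P-cong (∂x-*P (ι 1 +P X) v) (∂x-*P (T *P X) u)) ⟩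
  ∂x (ι 1 +P X) *P v +P (ι 1 +P X) *P ∂x v +P (∂x (T *P X) *P u +P T *P X *P ∂x u)
    ≈⟨ +P-cong (+P-congʳ _ (*P-congʳ v (∂ₑ-sound (ι 0) ∂x-ι (`lit 1 `+ `x))))
               (+P-congʳ _ (*P-congʳ u (∂ₑ-sound (ι 0) ∂x-ι (`t `* `x)))) ⟩
  (ι 0 +P ι 1) *P v +P (ι 1 +P X) *P ∂x v +P ((ι 0 *P X +P T *P ι 1) *P u +P T *P X *P ∂x u)
    ≈⟨ solve 6 (λ X T v u v′ u′ →
         (con (+ 0) :+ con (+ 1)) :* v :+ (con (+ 1) :+ X) :* v′
           :+ ((con (+ 0) :* X :+ T :* con (+ 1)) :* u :+ T :* X :* u′)
         := nextₛ T X v′ u′ :+ v :+ T :* u)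
         ≈P-refl X T v u (∂x v) (∂x u) ⟩
  next (∂x v) (∂x u) +P v +P T *P u ∎
  where
  open ≈P-Reasoning
  ∂x-ι : ∂x (ι 0) ≈P ι 0
  ∂x-ι = ∂x-cst (+ 0)

module Binomials where

  open import Data.Nat using (_+_; _*_)

  -- coeff b a e is the coefficient of t^(1+b) x^(1+b+a) in h (2+n), where n = b + a + e, and
  -- coeff⁻ₑ, coeff⁻ₐ, coeff⁻ᵦₑ are the same coefficient in h (1+n), x h (1+n) and t x h n.
  coeff coeff⁻ₑ coeff⁻ₐ coeff⁻ᵦₑ : ℕ → ℕ → ℕ → ℕ
  coeff b a e = ((a + e) choose a) * (e choose b)
  coeff⁻ₑ b a zero    = 0
  coeff⁻ₑ b a (suc e) = coeff b a e
  coeff⁻ₐ b zero    e = 0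
  coeff⁻ₐ b (suc a) e = coeff b a e
  coeff⁻ᵦₑ zero    a e       = 0
  coeff⁻ᵦₑ (suc b) a zero    = 0
  coeff⁻ᵦₑ (suc b) a (suc e) = coeff b a e

  diagonal-choose : ∀ a → (suc a + 0) choose suc a ≡ (a + 0) choose a
  diagonal-choose a = trans (trans (cong (λ k → k choose suc a) (ℕP.+-identityʳ (suc a))) (nCn≡1 (suc a)))
                            (sym (trans (cong (λ k → k choose a) (ℕP.+-identityʳ a)) (nCn≡1 a)))

  pascal : ∀ n k → suc n choose suc k ≡ n choose k + n choose suc k
  pascal n k = sym (nCk+nC[k+1]≡[n+1]C[k+1] n k)

  pascal-diagonal : ∀ a e →
    (suc a + suc e) choose suc a ≡ (a + suc e) choose a + (suc a + e) choose suc a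
  pascal-diagonal a e =
    trans (pascal (a + suc e) a) (cong (λ k → (a + suc e) choose a + k choose suc a) (ℕP.+-suc a e))

  coeff-pascal : ∀ b a e → 1 ≤ b + a + e →
    coeff b a e ≡ coeff⁻ₑ b a e + coeff⁻ₐ b a e + coeff⁻ᵦₑ b a e
  coeff-pascal zero    zero    zero    ()
  coeff-pascal (suc b) zero    zero    _ = refl
  coeff-pascal zero    (suc a) zero    _ = trans (cong (_* 1) (diagonal-choose a)) (sym (ℕP.+-identityʳ _))
  coeff-pascal (suc b) (suc a) zero    _ = trans (cong (_* 0) (diagonal-choose a)) (sym (ℕP.+-identityʳ _))
  coeff-pascal zero    zero    (suc e) _ = refl
  coeff-pascal (suc b) zero    (suc e) _ =
    trans (cong (1 *_) (pascal e b)) (rearrange₁ (e choose b) (e choose suc b))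
    where
    rearrange₁ : ∀ p q → 1 * (p + q) ≡ 1 * q + 0 + 1 * p
    rearrange₁ = solve-∀
  coeff-pascal zero    (suc a) (suc e) _ =
    trans (cong (_* 1) (pascal-diagonal a e)) (rearrange₂ ((a + suc e) choose a) ((suc a + e) choose suc a))
    where
    rearrange₂ : ∀ x y → (x + y) * 1 ≡ y * 1 + x * 1 + 0
    rearrange₂ = solve-∀
  coeff-pascal (suc b) (suc a) (suc e) _ = begin
    ((suc a + suc e) choose suc a) * r  ≡⟨ cong₂ _*_ (pascal-diagonal a e) (pascal e b) ⟩
    (x + y) * (p + q)                   ≡⟨ rearrange₃ x y p q ⟩
    y * q + x * (p + q) + y * p         ≡⟨ cong (λ k → y * q + x * k + y * p) (pascal e b) ⟨
    y * q + x * r + y * p               ∎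
    where
    open ≡-Reasoning
    x y p q r : ℕ
    x = (a + suc e) choose a
    y = (suc a + e) choose suc a
    p = e choose b
    q = e choose suc b
    r = suc e choose suc b
    rearrange₃ : ∀ x y p q → (x + y) * (p + q) ≡ y * q + x * (p + q) + y * p
    rearrange₃ = solve-∀

open Binomials

module CoefficientsOfH where

  open import Data.Integer using (_+_; _*_)

  next-coeff : ∀ v u i d → next v u i d ≡ v i d + shiftX v i d + shiftT (shiftX u) i d
  next-coeff v u i d = begin
    ((ι 1 +P X) *P v +P T *P X *P u) i d
      ≡⟨ cong₂ _+_ (*P-distribʳ-+P v (ι 1) X i d) (*P-assoc T X u i d) ⟩
    (ι 1 *P v) i d + (X *P v) i d + (T *P (X *P u)) i d
      ≡⟨ cong₂ _+_ (cong₂ _+_ (*P-identityˡ v i d) (X*P≈shiftX v i d))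
                   (trans (T*P≈shiftT (X *P u) i d) (shiftT-cong (X*P≈shiftX u) i d)) ⟩
    v i d + shiftX v i d + shiftT (shiftX u) i d ∎
    where open ≡-Reasoning

  if-true : ∀ {b} {x y : ℤ} → True b → (if b then x else y) ≡ x
  if-true {true} _ = refl

  if-false : ∀ {b} {x y : ℤ} → ¬ True b → (if b then x else y) ≡ y
  if-false {false} _   = refl
  if-false {true}  ¬tt = ⊥-elim (¬tt _)

  h-inside : ∀ {N i d} → 1 ≤ d → d < N → 1 ≤ i → i ≤ d →
    h N i d ≡ + (((N ∸ i ∸ 1) choose (d ∸ i)) ℕ.* ((N ∸ d ∸ 1) choose (i ∸ 1)))
  h-inside 1≤d d<N 1≤i i≤d = if-true
    (from T-∧ (ℕP.≤⇒≤ᵇ 1≤d , from T-∧ (ℕP.<⇒<ᵇ d<N , from T-∧ (ℕP.≤⇒≤ᵇ 1≤i , ℕP.≤⇒≤ᵇ i≤d))))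

  h-outside : ∀ N i d → ¬ (1 ≤ d × d < N × 1 ≤ i × i ≤ d) → h N i d ≡ + 0
  h-outside N i d outside = if-false λ inside →
    let (1≤d , rest) = to T-∧ inside
        (d<N , rest) = to T-∧ rest
        (1≤i , i≤d)  = to T-∧ rest
    in outside (ℕP.≤ᵇ⇒≤ 1 d 1≤d , ℕP.<ᵇ⇒< d N d<N , ℕP.≤ᵇ⇒≤ 1 i 1≤i , ℕP.≤ᵇ⇒≤ i d i≤d)

  h-t⁰ : ∀ N d → h N 0 d ≡ + 0
  h-t⁰ N d = h-outside N 0 d λ { (_ , _ , () , _) }

  h-beyond-degree : ∀ N i d → N ≤ d → h N i d ≡ + 0
  h-beyond-degree N i d N≤d = h-outside N i d λ (_ , d<N , _) → ℕP.<⇒≱ d<N N≤d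

  h-below-diagonal : ∀ N i d → d < i → h N i d ≡ + 0
  h-below-diagonal N i d d<i = h-outside N i d λ (_ , _ , _ , i≤d) → ℕP.<⇒≱ d<i i≤d

  h-as-coeff : ∀ b a e → h (suc (suc (b ℕ.+ a ℕ.+ e))) (suc b) (suc (b ℕ.+ a)) ≡ + coeff b a e
  h-as-coeff b a e = trans
    (h-inside (s≤s z≤n) (s≤s (s≤s (ℕP.m≤m+n (b ℕ.+ a) e))) (s≤s z≤n) (s≤s (ℕP.m≤m+n b a)))
    (cong +_ (cong₂ ℕ._*_ (cong₂ _choose_ (cong (_∸ 1) top) (ℕP.m+n∸m≡n b a))
                          (cong (λ k → k choose b) (cong (_∸ 1) bottom))))
    where
    top : suc (b ℕ.+ a ℕ.+ e) ∸ b ≡ suc (a ℕ.+ e)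
    top = trans (cong (λ k → suc k ∸ b) (ℕP.+-assoc b a e))
                (trans (cong (_∸ b) (sym (ℕP.+-suc b (a ℕ.+ e)))) (ℕP.m+n∸m≡n b _))
    bottom : suc (b ℕ.+ a ℕ.+ e) ∸ (b ℕ.+ a) ≡ suc e
    bottom = trans (cong (_∸ (b ℕ.+ a)) (sym (ℕP.+-suc (b ℕ.+ a) e))) (ℕP.m+n∸m≡n (b ℕ.+ a) _)

  h-as-coeff⁻ₑ : ∀ b a e → h (suc (b ℕ.+ a ℕ.+ e)) (suc b) (suc (b ℕ.+ a)) ≡ + coeff⁻ₑ b a e
  h-as-coeff⁻ₑ b a zero    =
    h-beyond-degree _ (suc b) (suc (b ℕ.+ a)) (s≤s (ℕP.≤-reflexive (ℕP.+-identityʳ (b ℕ.+ a))))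
  h-as-coeff⁻ₑ b a (suc e) =
    trans (cong (λ N → h N (suc b) (suc (b ℕ.+ a))) (cong suc (ℕP.+-suc (b ℕ.+ a) e))) (h-as-coeff b a e)

  h-as-coeff⁻ₐ : ∀ b a e → h (suc (b ℕ.+ a ℕ.+ e)) (suc b) (b ℕ.+ a) ≡ + coeff⁻ₐ b a e
  h-as-coeff⁻ₐ b zero    e = h-below-diagonal _ (suc b) (b ℕ.+ 0) (s≤s (ℕP.≤-reflexive (ℕP.+-identityʳ b)))
  h-as-coeff⁻ₐ b (suc a) e = trans
    (cong₂ (λ N d → h N (suc b) d) (cong suc (cong (ℕ._+ e) (ℕP.+-suc b a))) (ℕP.+-suc b a))
    (h-as-coeff b a e)

  h-as-coeff⁻ᵦₑ : ∀ b a e → h (b ℕ.+ a ℕ.+ e) b (b ℕ.+ a) ≡ + coeff⁻ᵦₑ b a e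
  h-as-coeff⁻ᵦₑ zero    a e       = h-t⁰ (a ℕ.+ e) a
  h-as-coeff⁻ᵦₑ (suc b) a zero    =
    h-beyond-degree _ (suc b) (suc b ℕ.+ a) (ℕP.≤-reflexive (ℕP.+-identityʳ (suc b ℕ.+ a)))
  h-as-coeff⁻ᵦₑ (suc b) a (suc e) =
    trans (cong (λ N → h N (suc b) (suc (b ℕ.+ a))) (cong suc (ℕP.+-suc (b ℕ.+ a) e))) (h-as-coeff b a e)

  h-recurrence-coeff : ∀ n → 1 ≤ n → ∀ i d →
    h (suc (suc n)) i d ≡ h (suc n) i d + shiftX (h (suc n)) i d + shiftT (shiftX (h n)) i d
  h-recurrence-coeff n 1≤n zero    zero    = refl
  h-recurrence-coeff n 1≤n zero    (suc d) = trans (h-t⁰ (suc (suc n)) (suc d))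
    (sym (cong₂ _+_ (cong₂ _+_ (h-t⁰ (suc n) (suc d)) (h-t⁰ (suc n) d)) refl))
  h-recurrence-coeff n 1≤n (suc b) zero    = refl
  h-recurrence-coeff n 1≤n (suc b) (suc d) with b ℕP.≤? d | d ℕP.≤? n
  ... | no b≰d | _ = trans (below (suc (suc n)) (suc d) (s≤s d<b))
    (sym (cong₂ _+_ (cong₂ _+_ (below (suc n) (suc d) (s≤s d<b)) (below (suc n) d (ℕP.m<n⇒m<1+n d<b)))
                    (h-below-diagonal n b d d<b)))
    where
    d<b = ℕP.≰⇒> b≰d
    below : ∀ N d → d < suc b → h N (suc b) d ≡ + 0
    below N d = h-below-diagonal N (suc b) d
  ... | yes _ | no d≰n = trans (beyond (suc (suc n)) (suc d) (s≤s n<d))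
    (sym (cong₂ _+_ (cong₂ _+_ (beyond (suc n) (suc d) (ℕP.m≤n⇒m≤1+n n<d)) (beyond (suc n) d n<d))
                    (h-beyond-degree n b d (ℕP.<⇒≤ n<d))))
    where
    n<d = ℕP.≰⇒> d≰n
    beyond : ∀ N d → N ≤ d → h N (suc b) d ≡ + 0
    beyond N d = h-beyond-degree N (suc b) d
  ... | yes b≤d | yes d≤n with ℕP.m≤n⇒∃[o]m+o≡n b≤d | ℕP.m≤n⇒∃[o]m+o≡n d≤n
  ... | a , refl | e , refl = begin
    h (suc (suc (b ℕ.+ a ℕ.+ e))) (suc b) (suc (b ℕ.+ a))
      ≡⟨ h-as-coeff b a e ⟩
    + coeff b a e
      ≡⟨ cong +_ (coeff-pascal b a e 1≤n) ⟩
    + coeff⁻ₑ b a e + + coeff⁻ₐ b a e + + coeff⁻ᵦₑ b a e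
      ≡⟨ cong₂ _+_ (cong₂ _+_ (h-as-coeff⁻ₑ b a e) (h-as-coeff⁻ₐ b a e)) (h-as-coeff⁻ᵦₑ b a e) ⟨
    h (suc (b ℕ.+ a ℕ.+ e)) (suc b) (suc (b ℕ.+ a)) + h (suc (b ℕ.+ a ℕ.+ e)) (suc b) (b ℕ.+ a)
      + h (b ℕ.+ a ℕ.+ e) b (b ℕ.+ a) ∎
    where open ≡-Reasoning

  h-recurrence : ∀ n → 1 ≤ n → h (suc (suc n)) ≈P next (h (suc n)) (h n)
  h-recurrence n 1≤n i d = trans (h-recurrence-coeff n 1≤n i d) (sym (next-coeff (h (suc n)) (h n) i d))

  h₁≈0 : h 1 ≈P ι 0
  h₁≈0 i zero    = sym (cst-0 i 0)
  h₁≈0 i (suc d) = sym (cst-0 i (suc d))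

  h₂≈tx : h 2 ≈P T *P X
  h₂≈tx i d = trans (h₂-coeff i d) (sym (T*P≈shiftT X i d))
    where
    h₂-coeff : ∀ i d → h 2 i d ≡ shiftT X i d
    h₂-coeff zero          zero          = refl
    h₂-coeff zero          (suc zero)    = refl
    h₂-coeff zero          (suc (suc d)) = refl
    h₂-coeff (suc zero)    zero          = refl
    h₂-coeff (suc zero)    (suc zero)    = refl
    h₂-coeff (suc zero)    (suc (suc d)) = refl
    h₂-coeff (suc (suc i)) zero          = refl
    h₂-coeff (suc (suc i)) (suc zero)    = refl
    h₂-coeff (suc (suc i)) (suc (suc d)) = refl

open CoefficientsOfH

ode₁-defect : Poly → Poly → Poly → Poly → Poly
ode₁-defect N w v v′ = ⟦ `A ⟧ N *P w -P (⟦ `B ⟧ N *P v +P C *P v′)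

ode₁-defectₛ : ∀ {k} → (n t x w v v′ : Polynomial k) → Polynomial k
ode₁-defectₛ n t x w v v′ = ⟦ `A ⟧ₛ n t x :* w :- (⟦ `B ⟧ₛ n t x :* v :+ ⟦ `C ⟧ₛ n t x :* v′)

ode₁-defect-cong : ∀ {N N′ w w′ v v′ dv dv′} → N ≈P N′ → w ≈P w′ → v ≈P v′ → dv ≈P dv′ →
  ode₁-defect N w v dv ≈P ode₁-defect N′ w′ v′ dv′
ode₁-defect-cong N≈N′ w≈w′ v≈v′ dv≈dv′ =
  +P-cong (*P-cong (⟦⟧-cong `A N≈N′) w≈w′)
          (-P-cong (+P-cong (*P-cong (⟦⟧-cong `B N≈N′) v≈v′) (*P-congˡ C dv≈dv′)))

ode₁-defect-next : ∀ N v u v′ u′ →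
  ode₁-defect (N +P ι 1 +P ι 1) (next (next v u) v) (next v u) (next v′ u′ +P v +P T *P u)
  ≈P next (ode₁-defect (N +P ι 1) (next v u) v v′) (ode₁-defect N v u u′)
ode₁-defect-next N v u v′ u′ = solve 7 (λ N T X v u v′ u′ →
    let one = con (+ 1)
        nx  = nextₛ T X
        δ   = λ n → ode₁-defectₛ n T X
    in δ (N :+ one :+ one) (nx (nx v u) v) (nx v u) (nx v′ u′ :+ v :+ T :* u)
       := nx (δ (N :+ one) (nx v u) v v′) (δ N v u u′))
  ≈P-refl N T X v u v′ u′

-- Indexed from n = 1, where the recurrence for h starts to hold.
ode₁-defect-of-h : ℕ → Poly
ode₁-defect-of-h k = ode₁-defect (ι (suc k)) (h (suc (suc k))) (h (suc k)) (∂x (h (suc k)))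

∂x-h₁ : ∂x (h 1) ≈P ι 0
∂x-h₁ = ≈P-trans (∂x-cong h₁≈0) (∂x-cst (+ 0))

∂x-h₂ : ∂x (h 2) ≈P ι 0 *P X +P T *P ι 1
∂x-h₂ = ≈P-trans (∂x-cong h₂≈tx) (∂ₑ-sound (ι 0) (∂x-cst (+ 0)) (`t `* `x))

h₃≈next : h 3 ≈P next (T *P X) (ι 0)
h₃≈next = ≈P-trans (h-recurrence 1 (s≤s z≤n)) (next-cong h₂≈tx h₁≈0)

ode₁-defect-of-h₀ : ode₁-defect-of-h 0 ≈P ι 0
ode₁-defect-of-h₀ = ≈P-trans (ode₁-defect-cong (≈P-refl {ι 1}) h₂≈tx h₁≈0 ∂x-h₁)
  (solve 2 (λ T X → ode₁-defectₛ (con (+ 1)) T X (T :* X) (con (+ 0)) (con (+ 0)) := con (+ 0))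
         ≈P-refl T X)

ode₁-defect-of-h₁ : ode₁-defect-of-h 1 ≈P ι 0
ode₁-defect-of-h₁ = ≈P-trans (ode₁-defect-cong (≈P-refl {ι 2}) h₃≈next h₂≈tx ∂x-h₂)
  (solve 2 (λ T X →
     ode₁-defectₛ (con (+ 2)) T X (nextₛ T X (T :* X) (con (+ 0))) (T :* X)
                  (con (+ 0) :* X :+ T :* con (+ 1))
     := con (+ 0))
   ≈P-refl T X)

ode₁-defect-of-h-next : ∀ k →
  ode₁-defect-of-h (suc (suc k)) ≈P next (ode₁-defect-of-h (suc k)) (ode₁-defect-of-h k)
ode₁-defect-of-h-next k = begin
  ode₁-defect (ι (3 ℕ.+ k)) (h (4 ℕ.+ k)) (h (3 ℕ.+ k)) (∂x (h (3 ℕ.+ k)))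
    ≈⟨ ode₁-defect-cong ι₃ h₄ h₃ ∂x-h₃ ⟩
  ode₁-defect (N +P ι 1 +P ι 1) (next (next v u) v) (next v u) (next v′ u′ +P v +P T *P u)
    ≈⟨ ode₁-defect-next N v u v′ u′ ⟩
  next (ode₁-defect (N +P ι 1) (next v u) v v′) (ode₁-defect N v u u′)
    ≈⟨ next-cong (ode₁-defect-cong (ι-suc (suc k)) h₃ (≈P-refl {v}) (≈P-refl {v′}))
                 (≈P-refl {ode₁-defect N v u u′}) ⟨
  next (ode₁-defect-of-h (suc k)) (ode₁-defect-of-h k) ∎
  where
  open ≈P-Reasoning
  N u v u′ v′ : Poly
  N  = ι (suc k)
  u  = h (suc k)
  v  = h (suc (suc k))
  u′ = ∂x u
  v′ = ∂x v
  ι₃ : ι (3 ℕ.+ k) ≈P N +P ι 1 +P ι 1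
  ι₃ = ≈P-trans (ι-suc (2 ℕ.+ k)) (+P-congʳ (ι 1) (ι-suc (suc k)))
  h₃ : h (3 ℕ.+ k) ≈P next v u
  h₃ = h-recurrence (suc k) (s≤s z≤n)
  h₄ : h (4 ℕ.+ k) ≈P next (next v u) v
  h₄ = ≈P-trans (h-recurrence (2 ℕ.+ k) (s≤s z≤n)) (next-cong h₃ (≈P-refl {v}))
  ∂x-h₃ : ∂x (h (3 ℕ.+ k)) ≈P next v′ u′ +P v +P T *P u
  ∂x-h₃ = ≈P-trans (∂x-cong h₃) (∂x-next v u)

ode₁-defect-of-h≈0 : ∀ k → ode₁-defect-of-h k ≈P ι 0
ode₁-defect-of-h≈0 = recurrence-from-zeros (CommutativeRing.semiring Poly-commutativeRing)
  (ι 1 +P X) (T *P X) ode₁-defect-of-h ode₁-defect-of-h₀ ode₁-defect-of-h₁ ode₁-defect-of-h-next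

ode₁ : ∀ m → A (suc m) *P h (suc (suc m)) ≈P B (suc m) *P h (suc m) +P C *P ∂x (h (suc m))
ode₁ m = x∙y⁻¹≈ε⇒x≈y _ _
  (≈P-trans (+P-congʳ (-P (B (suc m) *P h (suc m) +P C *P ∂x (h (suc m))))
                      (*P-congʳ (h (suc (suc m))) (A-as-expr m)))
            (ode₁-defect-of-h≈0 m))

ode₁-defect′ : Poly → Poly → Poly → Poly → Poly → Poly → Poly
ode₁-defect′ N w v w′ v′ v″ =
  ⟦ ∂ₑ `A ⟧ N *P w +P ⟦ `A ⟧ N *P w′
  -P (⟦ ∂ₑ `B ⟧ N *P v +P ⟦ `B ⟧ N *P v′ +P (⟦ ∂ₑ `C ⟧ N *P v′ +P C *P v″))

∂x-ode₁-defect : ∀ N → ∂x N ≈P ι 0 → ∀ w v →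
  ∂x (ode₁-defect N w v (∂x v)) ≈P ode₁-defect′ N w v (∂x w) (∂x v) (∂x (∂x v))
∂x-ode₁-defect N ∂N≈0 w v = begin
  ∂x (a *P w +P -P (b *P v +P C *P v′))
    ≈⟨ ∂x-+P (a *P w) (-P (b *P v +P C *P v′)) ⟩
  ∂x (a *P w) +P ∂x (-P (b *P v +P C *P v′))
    ≈⟨ +P-cong (∂x-*P a w) (≈P-trans (∂x--P (b *P v +P C *P v′))
                                     (-P-cong (≈P-trans (∂x-+P (b *P v) (C *P v′))
                                                        (+P-cong (∂x-*P b v) (∂x-*P C v′))))) ⟩
  ∂x a *P w +P a *P ∂x w -P (∂x b *P v +P b *P ∂x v +P (∂x C *P v′ +P C *P ∂x v′))
    ≈⟨ +P-cong (+P-congʳ (a *P ∂x w) (*P-congʳ w (∂ₑ-sound N ∂N≈0 `A)))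
               (-P-cong (+P-cong (+P-congʳ (b *P ∂x v) (*P-congʳ v (∂ₑ-sound N ∂N≈0 `B)))
                                 (+P-congʳ (C *P ∂x v′) (*P-congʳ v′ (∂ₑ-sound N ∂N≈0 `C))))) ⟩
  ode₁-defect′ N w v (∂x w) (∂x v) (∂x v′) ∎
  where
  open ≈P-Reasoning
  a b v′ : Poly
  a  = ⟦ `A ⟧ N
  b  = ⟦ `B ⟧ N
  v′ = ∂x v

ode₂-defect : Poly → Poly → Poly → Poly → Poly
ode₂-defect N w v v″ = ⟦ `Ã ⟧ N *P w -P (⟦ `B̃ ⟧ N *P v +P C *P C *P v″)

ode₂-defect-decomposition : ∀ N w v w′ v′ v″ →
  ode₂-defect N w v v″
  ≈P C *P ode₁-defect′ N w v w′ v′ v″ +P ⟦ `A ⟧ N *P ode₁-defect (N +P ι 1) (next w v) w w′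
     -P (⟦ `B ⟧ N +P ⟦ ∂ₑ `C ⟧ N) *P ode₁-defect N w v v′
ode₂-defect-decomposition N w v w′ v′ v″ = solve 8 (λ N T X w v w′ v′ v″ →
    let ⟦_⟧′ = λ e → ⟦ e ⟧ₛ N T X
        δ    = λ n → ode₁-defectₛ n T X
        δ′   = ⟦ ∂ₑ `A ⟧′ :* w :+ ⟦ `A ⟧′ :* w′
               :- (⟦ ∂ₑ `B ⟧′ :* v :+ ⟦ `B ⟧′ :* v′ :+ (⟦ ∂ₑ `C ⟧′ :* v′ :+ ⟦ `C ⟧′ :* v″))
    in ⟦ `Ã ⟧′ :* w :- (⟦ `B̃ ⟧′ :* v :+ ⟦ `C ⟧′ :* ⟦ `C ⟧′ :* v″)
       := ⟦ `C ⟧′ :* δ′ :+ ⟦ `A ⟧′ :* δ (N :+ con (+ 1)) (nextₛ T X w v) w w′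
          :- (⟦ `B ⟧′ :+ ⟦ ∂ₑ `C ⟧′) :* δ N w v v′)
  ≈P-refl N T X w v w′ v′ v″

ode₂ : ∀ m →
  Ã (suc m) *P h (suc (suc m)) ≈P B̃ (suc m) *P h (suc m) +P (C *P C) *P ∂x (∂x (h (suc m)))
ode₂ m = x∙y⁻¹≈ε⇒x≈y _ _ (begin
  Ã (suc m) *P w -P (B̃ (suc m) *P v +P C *P C *P v″)
    ≈⟨ +P-congʳ (-P (B̃ (suc m) *P v +P C *P C *P v″)) (*P-congʳ w (Ã-as-expr m)) ⟩
  ode₂-defect N w v v″
    ≈⟨ ode₂-defect-decomposition N w v w′ v′ v″ ⟩
  C *P ode₁-defect′ N w v w′ v′ v″ +P a *P ode₁-defect (N +P ι 1) (next w v) w w′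
    -P b *P ode₁-defect N w v v′
    ≈⟨ +P-cong (+P-cong (*P-congˡ C derivative≈0) (*P-congˡ a next≈0)) (-P-cong (*P-congˡ b current≈0)) ⟩
  C *P ι 0 +P a *P ι 0 -P b *P ι 0
    ≈⟨ solve 3 (λ C a b → C :* con (+ 0) :+ a :* con (+ 0) :- b :* con (+ 0) := con (+ 0)) ≈P-refl C a b ⟩
  ι 0 ∎)
  where
  open ≈P-Reasoning
  N w v w′ v′ v″ a b : Poly
  N  = ι (suc m)
  w  = h (suc (suc m))
  v  = h (suc m)
  w′ = ∂x w
  v′ = ∂x v
  v″ = ∂x v′
  a  = ⟦ `A ⟧ N
  b  = ⟦ `B ⟧ N +P ⟦ ∂ₑ `C ⟧ N
  current≈0 : ode₁-defect N w v v′ ≈P ι 0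
  current≈0 = ode₁-defect-of-h≈0 m
  next≈0 : ode₁-defect (N +P ι 1) (next w v) w w′ ≈P ι 0
  next≈0 = ≈P-trans (ode₁-defect-cong (≈P-sym (ι-suc (suc m))) (≈P-sym (h-recurrence (suc m) (s≤s z≤n)))
                                       (≈P-refl {w}) (≈P-refl {w′}))
                    (ode₁-defect-of-h≈0 (suc m))
  derivative≈0 : ode₁-defect′ N w v w′ v′ v″ ≈P ι 0
  derivative≈0 = ≈P-trans (≈P-sym (∂x-ode₁-defect N (∂x-cst (+ suc m)) w v))
                          (≈P-trans (∂x-cong current≈0) (∂x-cst (+ 0)))

open import Data.Nat using (_+_)

theorem2p1 : (n : ℕ) → 2 ≤ n →
    (h (n + 2) ≈P (ι 1 +P X) *P h (n + 1) +P T *P X *P h n)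
    × (A n *P h (n + 1) ≈P B n *P h n +P C *P ∂x (h n))
    × (Ã n *P h (n + 1) ≈P B̃ n *P h n +P (C *P C) *P ∂x (∂x (h n)))
theorem2p1 (suc m) (s≤s _) rewrite ℕP.+-comm m 2 | ℕP.+-comm m 1 =
  h-recurrence (suc m) (s≤s z≤n) , ode₁ m , ode₂ m
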